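{- Let $\psi$ be an $\mathrm{FO}^3(<,\mathrm{succ},\mathrm{min},\mathrm{max})$-formula, let $A,B$ be sets of interpretations such that every interpretation in $A$ satisfies $\psi$ and every interpretation in $B$ satisfies $\neg\psi$, and let $\mathcal{T}$ be an extended syntax tree $\mathcal{T}^{\langle A,B\rangle}_\psi$. Then for every node $v$ of $\mathcal{T}$ and every minimal separator $\delta$ for $il(v)$: (a) if $v$ is a leaf, then $w(\delta)\le1$; (b) if $v$ has two children $v_1,v_2$ and $\delta_i$ is a minimal separator for $il(v_i)$ ($i=1,2$), then $w(\delta)\le w(\delta_1)+w(\delta_2)$; (c) if $v$ has exactly one child $v_1$ and $\delta_1$ is a minimal separator for $il(v_1)$, then $w(\delta)\le w(\delta_1)+2$.
   Context: Structures $\mathcal{A}_N$ ($N\in\mathbb{N}$): universe $\{0,\dots,N\}$, natural $<$, $\mathrm{succ}=\{(a,a+1)\}$, $\mathrm{min}=0$, $\mathrm{max}=N$. $\mathrm{FO}^3(<,\mathrm{succ},\mathrm{min},\mathrm{max})$: first-order formulas over this signature with variables $x,y,z$ only, built from atoms $R(u,u')$ ($R\in\{<,=,\mathrm{succ}\}$, $u,u'\in\{\mathrm{min},\mathrm{max},x,y,z\}$) by $\neg,\vee,\wedge,\exists,\forall$. An interpretation is $(\mathcal{A},\alpha)$ with $\mathcal{A}=\mathcal{A}_N$ and $\alpha\colon\{x,y,z\}\to\{0,\dots,N\}$, extended by $\alpha(\mathrm{min})=0,\alpha(\mathrm{max})=N$; $\alpha[a/u]$ is $\alpha$ modified to map $u$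 to $a$. $\mathrm{diff}(m,n)=m-n$; $<\!\text{ -type}(m,n)\in\{<,=,>\}$. A potential separator is $\delta\colon\mathcal{P}_2(\{\mathrm{min},\mathrm{max},x,y,z\})\to\mathbb{N}$ ($\mathcal{P}_2$ = 2-element subsets); it is a separator for $\langle A,B\rangle$ if for every $(\mathcal{A},\alpha)\in A$, $(\mathcal{B},\beta)\in B$ there are distinct $u,u'$ with $\delta(\{u,u'\})\ge1$ and either $<\!\text{ -type}(\alpha(u),\alpha(u'))\ne<\!\text{ -type}(\beta(u),\beta(u'))$, or [$\delta(\{u,u'\})\ge\min\{|\mathrm{diff}(\alpha(u),\alpha(u'))|,|\mathrm{diff}(\beta(u),\beta(u'))|\}$ and $\mathrm{diff}(\alpha(u),\alpha(u'))\ne\mathrm{diff}(\beta(u),\beta(u'))$]. Let $b(\delta)=\max\{\delta(\{\mathrm{min},\mathrm{max}\}),\delta(\{\mathrm{min},u\})+\delta(\{u',\mathrm{max}\}):u,u'\in\{x,y,z\}\}$, $c(\delta)=\max\{\delta(p)+\delta(q):p\ne q\in\mathcal{P}_2(\{x,y,z\})\}$, $w(\delta)=\sqrt{c(\delta)^2+b(\delta)}$. A minimal separator for $\langle A,B\rangle$ is a separator of minimum weight. Extended syntax tree $\mathcal{T}^{\langle A,B\rangle}_\psi$ (for $A\models\psi$, $B\models\neg\psi$), defined by induction on $\psi$; every node $v$ has a syntax label $sl(v)$ and an interpretation label $il(v)$, and the root has $il=\langle A,B\rangle$. If $\psi$ is atomic: a single node with $sl=\psi$. If $\psi=\neg\psi_1$: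 root with $sl=\neg$, whose child is the root of $\mathcal{T}^{\langle B,A\rangle}_{\psi_1}$. If $\psi=\psi_1\vee\psi_2$: root with $sl=\vee$, children the roots of $\mathcal{T}^{\langle A_i,B\rangle}_{\psi_i}$ where $A_i=\{I\in A: I\models\psi_i\}$. If $\psi=\psi_1\wedge\psi_2$: root with $sl=\wedge$, children the roots of $\mathcal{T}^{\langle A,B_i\rangle}_{\psi_i}$ where $B_i=\{J\in B: J\not\models\psi_i\}$. If $\psi=\exists u\,\psi_1$: root with $sl=\exists u$, child the root of $\mathcal{T}^{\langle A_1,B_1\rangle}_{\psi_1}$ where $B_1=\{(\mathcal{B},\beta[b/u]):(\mathcal{B},\beta)\in B, b\in$ universe of $\mathcal{B}\}$ and $A_1=\{(\mathcal{A},\alpha[a/u]):(\mathcal{A},\alpha)\in A\}$ with, for each $(\mathcal{A},\alpha)\in A$, one fixed element $a$ such that $(\mathcal{A},\alpha[a/u])\models\psi_1$. If $\psi=\forall u\,\psi_1$: dually, $A_1=\{(\mathcal{A},\alpha[a/u]):(\mathcal{A},\alpha)\in A, a$ in the universe$\}$ and $B_1$ contains, for each $(\mathcal{B},\beta)\in B$, one $(\mathcal{B},\beta[b/u])$ with a fixed $b$ such that $(\mathcal{B},\beta[b/u])\models\neg\psi_1$. -}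

module Defs where

open import Data.Nat using (ℕ; zero; suc; _+_; _*_; _∸_; _≤_; _<_; _⊔_; _⊓_; ∣_-_∣)
open import Data.Integer using (ℤ; +_) renaming (_-_ to _-ℤ_)
open import Data.Product using (Σ; _×_; _,_; proj₁; proj₂)
open import Data.Sum using (_⊎_)
open import Data.Unit using (⊤)
open import Data.List using (List; []; _∷_; map)
open import Data.List.Membership.Propositional using (_∈_)
open import Relation.Nullary using (¬_)
open import Relation.Binary.PropositionalEquality using (_≡_; _≢_)

data Var : Set where
  x y z : Var

data Term : Set where
  mn mx : Term
  var : Var → Term

data Rel : Set where
  lt eq sc : Rel

data Form : Set where
  atom : Rel → Term → Term → Form
  ¬'_ : Form → Form
  _∨'_ _∧'_ : Form → Form → Form
  ∃' ∀' : Var → Form → Form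

-- Interpretations (A_N, α): universe {0,…,N}, α : {x,y,z} → {0,…,N}

record Interp : Set where
  constructor mkI
  field
    N ax ay az : ℕ
    bx : ax ≤ N
    by : ay ≤ N
    bz : az ≤ N
open Interp public

val : Interp → Term → ℕ
val I mn = 0
val I mx = N I
val I (var x) = ax I
val I (var y) = ay I
val I (var z) = az I

update : (I : Interp) → Var → (a : ℕ) → a ≤ N I → Interp
update (mkI N ax ay az bx by bz) x a p = mkI N a ay az p by bz
update (mkI N ax ay az bx by bz) y a p = mkI N ax a az bx p bz
update (mkI N ax ay az bx by bz) z a p = mkI N ax ay a bx by p

_⊨_ : Interp → Form → Set
I ⊨ atom lt u u' = val I u < val I u'
I ⊨ atom eq u u' = val I u ≡ val I u'
I ⊨ atom sc u u' = suc (val I u) ≡ val I u'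
I ⊨ (¬' φ) = ¬ (I ⊨ φ)
I ⊨ (φ ∨' ψ) = (I ⊨ φ) ⊎ (I ⊨ ψ)
I ⊨ (φ ∧' ψ) = (I ⊨ φ) × (I ⊨ ψ)
I ⊨ ∃' v φ = Σ ℕ λ a → Σ (a ≤ N I) λ p → update I v a p ⊨ φ
I ⊨ ∀' v φ = (a : ℕ) (p : a ≤ N I) → update I v a p ⊨ φ

Pred : Set₁
Pred = Interp → Set

data Tree : Form → Pred → Pred → Set₁ where
  leaf : ∀ {r u u' A B} → Tree (atom r u u') A B
  neg  : ∀ {φ A B} → Tree φ B A → Tree (¬' φ) A B
  or   : ∀ {φ₁ φ₂ A B}
       → Tree φ₁ (λ I → A I × (I ⊨ φ₁)) B
       → Tree φ₂ (λ I → A I × (I ⊨ φ₂)) B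
       → Tree (φ₁ ∨' φ₂) A B
  and  : ∀ {φ₁ φ₂ A B}
       → Tree φ₁ A (λ J → B J × ¬ (J ⊨ φ₁))
       → Tree φ₂ A (λ J → B J × ¬ (J ⊨ φ₂))
       → Tree (φ₁ ∧' φ₂) A B
  -- ch fixes, for each interpretation in A, one witness element
  ex   : ∀ {φ v A B} (ch : Interp → ℕ)
       → (∀ I → A I → Σ (ch I ≤ N I) λ p → update I v (ch I) p ⊨ φ)
       → Tree φ (λ J → Σ Interp λ I → A I × Σ (ch I ≤ N I) λ p → J ≡ update I v (ch I) p)
                (λ J → Σ Interp λ I → B I × Σ ℕ λ b → Σ (b ≤ N I) λ p → J ≡ update I v b p)
       → Tree (∃' v φ) A B
  all  : ∀ {φ v A B} (ch : Interp → ℕ)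
       → (∀ J → B J → Σ (ch J ≤ N J) λ p → update J v (ch J) p ⊨ (¬' φ))
       → Tree φ (λ I → Σ Interp λ I' → A I' × Σ ℕ λ a → Σ (a ≤ N I') λ p → I ≡ update I' v a p)
                (λ J → Σ Interp λ J' → B J' × Σ (ch J' ≤ N J') λ p → J ≡ update J' v (ch J') p)
       → Tree (∀' v φ) A B

record Node : Set₁ where
  constructor node
  field
    {fm} : Form
    {lA lB} : Pred
    tree : Tree fm lA lB
open Node public

kids : ∀ {φ A B} → Tree φ A B → List Node
kids leaf = []
kids (neg t) = node t ∷ []
kids (or t₁ t₂) = node t₁ ∷ node t₂ ∷ []
kids (and t₁ t₂) = node t₁ ∷ node t₂ ∷ []
kids (ex _ _ t) = node t ∷ []
kids (all _ _ t) = node t ∷ []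

data _≼_ (s : Node) : Node → Set₁ where
  here  : s ≼ s
  there : ∀ {t c} → c ∈ kids (tree t) → s ≼ c → s ≼ t

Label : Set₁
Label = Pred × Pred

il : Node → Label
il n = lA n , lB n

-- the 2-element subsets of {min,max,x,y,z}
data Pair : Set where
  mnmx mnx mny mnz mxx mxy mxz xy xz yz : Pair

ends : Pair → Term × Term
ends mnmx = mn , mx
ends mnx = mn , var x
ends mny = mn , var y
ends mnz = mn , var z
ends mxx = mx , var x
ends mxy = mx , var y
ends mxz = mx , var z
ends xy = var x , var y
ends xz = var x , var z
ends yz = var y , var z

data OType : Set where
  ltT eqT gtT : OType

otype : ℕ → ℕ → OType
otype zero zero = eqT
otype zero (suc n) = ltT
otype (suc m) zero = gtT
otype (suc m) (suc n) = otype m n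

diff : ℕ → ℕ → ℤ
diff m n = (+ m) -ℤ (+ n)

PotSep : Set
PotSep = Pair → ℕ

SepAt : PotSep → Interp → Interp → Pair → Set
SepAt δ I J p =
  1 ≤ δ p ×
  ( otype (val I u) (val I u') ≢ otype (val J u) (val J u')
  ⊎ ( (∣ val I u - val I u' ∣ ⊓ ∣ val J u - val J u' ∣) ≤ δ p
    × diff (val I u) (val I u') ≢ diff (val J u) (val J u')))
  where
    u = proj₁ (ends p)
    u' = proj₂ (ends p)

IsSeparator : Label → PotSep → Set
IsSeparator (A , B) δ = ∀ I J → A I → B J → Σ Pair λ p → SepAt δ I J p

bδ : PotSep → ℕ
bδ δ = δ mnmx ⊔ (sx ⊔ sy ⊔ sz)
  where
    mxv : Var → ℕ
    mxv x = δ mxx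
    mxv y = δ mxy
    mxv z = δ mxz
    s : ℕ → ℕ
    s a = (a + mxv x) ⊔ (a + mxv y) ⊔ (a + mxv z)
    sx = s (δ mnx)
    sy = s (δ mny)
    sz = s (δ mnz)

cδ : PotSep → ℕ
cδ δ = (δ xy + δ xz) ⊔ (δ xy + δ yz) ⊔ (δ xz + δ yz)

-- W δ = w(δ)² = c(δ)² + b(δ); w(δ) = √(W δ)
W : PotSep → ℕ
W δ = cδ δ * cδ δ + bδ δ

-- minimal separator: a separator of minimum weight (w monotone in W)
IsMinSep : Label → PotSep → Set
IsMinSep L δ = IsSeparator L δ × (∀ δ' → IsSeparator L δ' → W δ ≤ W δ')

-- SqrtLe a b c  ⟺  √a ≤ √b + √c  (over the reals), for a b c ∈ ℕ
SqrtLe : ℕ → ℕ → ℕ → Set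
SqrtLe a b c = a ≤ b + c ⊎ (b + c < a × (a ∸ (b + c)) * (a ∸ (b + c)) ≤ 4 * (b * c))

Claim : Label → List Label → Set
Claim L [] = ∀ δ → IsMinSep L δ → W δ ≤ 1
Claim L (L₁ ∷ []) = ∀ δ δ₁ → IsMinSep L δ → IsMinSep L₁ δ₁ → SqrtLe (W δ) (W δ₁) 4
Claim L (L₁ ∷ L₂ ∷ []) = ∀ δ δ₁ δ₂ → IsMinSep L δ → IsMinSep L₁ δ₁ → IsMinSep L₂ δ₂
                        → SqrtLe (W δ) (W δ₁) (W δ₂)
Claim L (_ ∷ _ ∷ _ ∷ _) = ⊤

NodeClaim : Node → Set
NodeClaim v = Claim (il v) (map il (kids (tree v)))

module Submission where

-- Each claim bounds the weight of a minimal separator at a node by that of separators at its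
-- children, so it suffices to build from separators of the children a separator of the node of
-- controlled weight.  At a leaf, the pair of the atom's two terms with value 1 separates, since a
-- gap of absolute value at most 1 is determined exactly.  At ∨ and ∧ the pointwise sum δ₁ ⊕ δ₂
-- separates, and as b and c are subadditive, w(δ₁ ⊕ δ₂)² ≤ w(δ₁)² + w(δ₂)² + 2 c(δ₁) c(δ₂), which
-- is at most (w(δ₁) + w(δ₂))².  At a quantifier over v, the separator `quantSep v δ₁` drops the
-- pairs containing v and raises every other pair {s,t} to δ₁{v,s} + δ₁{v,t} + 1.  If two
-- interpretations are not separated by it, an Ehrenfeucht–Fraïssé argument on the two linear
-- orders matches every choice for v in one by a choice in the other that is not separated by δ₁.
-- Here c grows by at most 1 and b by at most 2c + 2, so w(quantSep v δ₁)² ≤ (w(δ₁) + 2)².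

open import Defs
open import Data.Bool using (Bool; _∨_; if_then_else_)
open import Data.Empty using (⊥; ⊥-elim)
open import Data.Integer as ℤ using (ℤ; +_; +0; +[1+_]; -[1+_]; 0ℤ; 1ℤ; -_; +≤+; +<+)
import Data.Integer.Properties as ℤ
open import Data.List using (List; []; _∷_; filter)
open import Data.List.Extrema ℤ.≤-totalOrder using (argmax; argmax-sel; f[xs]≤f[argmax])
open import Data.List.Membership.Propositional using (_∈_; find; lose)
open import Data.List.Membership.Propositional.Properties using (∈-filter⁺; ∈-filter⁻)
import Data.List.Relation.Unary.All as All
open import Data.List.Relation.Unary.Any using (here; there; any?; satisfied)
open import Data.Nat as ℕ using (ℕ; zero; suc; z≤n; s≤s; _⊓_; _⊔_; ∣_-_∣)
import Data.Nat.Properties as ℕ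
open import Data.Product using (Σ; _×_; _,_; proj₁; proj₂)
open import Data.Sum using (_⊎_; inj₁; inj₂; [_,_]′)
open import Function using (_∘_; id)
open import Function.Bundles using (_⇔_; mk⇔; Equivalence)
open import Relation.Binary.PropositionalEquality using (_≡_; _≢_; refl; sym; trans; cong; cong₂; subst; subst₂)
open import Relation.Nullary using (¬_; Dec; yes; no; does; contradiction)
open import Relation.Nullary.Decidable using (_×-dec_; ¬?; map′; dec-false)

-- Agreement of gaps

module _ where
  open import Data.Integer using (_+_; _-_; _≤_; _<_) renaming (suc to sucℤ)
  open import Data.Integer.Tactic.RingSolver using (solve-∀)

  -- A pair whose gaps in two interpretations are d and d' is not separated by a separator
  -- value k ≥ 1 exactly when `Agree k d d'` (see `sepAt-or-indist`).
  data Agree (k : ℕ) : ℤ → ℤ → Set where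
    equal : ∀ {d} → Agree k d d
    above : ∀ {d d'} → + k < d → + k < d' → Agree k d d'
    below : ∀ {d d'} → + k < - d → + k < - d' → Agree k d d'

  private
    variable
      j k r : ℕ
      d d' e : ℤ

  Agree-sym : Agree k d d' → Agree k d' d
  Agree-sym equal = equal
  Agree-sym (above p q) = above q p
  Agree-sym (below p q) = below q p

  Agree-mono : j ℕ.≤ k → Agree k d d' → Agree j d d'
  Agree-mono j≤k equal = equal
  Agree-mono j≤k (above p q) = above (ℤ.≤-<-trans (+≤+ j≤k) p) (ℤ.≤-<-trans (+≤+ j≤k) q)
  Agree-mono j≤k (below p q) = below (ℤ.≤-<-trans (+≤+ j≤k) p) (ℤ.≤-<-trans (+≤+ j≤k) q)

  Agree-neg : Agree k d d' → Agree k (- d) (- d')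
  Agree-neg equal = equal
  Agree-neg {d = d} {d'} (above p q) =
    below (subst (_ <_) (sym (ℤ.neg-involutive d)) p) (subst (_ <_) (sym (ℤ.neg-involutive d')) q)
  Agree-neg (below p q) = above p q

  private
    above-below-absurd : + k < d → + k < - d → ⊥
    above-below-absurd {d = +0} (+<+ ()) _
    above-below-absurd {d = +[1+ _ ]} _ ()
    above-below-absurd {d = -[1+ _ ]} () _

  Agree-beyond : Agree k d d' → + k < d → + k < d'
  Agree-beyond equal p = p
  Agree-beyond (above _ q) _ = q
  Agree-beyond (below p _) q = ⊥-elim (above-below-absurd q p)

  private
    nonneg-below-absurd : 0ℤ ≤ d → + k < - d → ⊥
    nonneg-below-absurd {d = +0} _ (+<+ ())
    nonneg-below-absurd {d = +[1+ _ ]} _ ()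

  Agree-nonneg : Agree k d d' → 0ℤ ≤ d → 0ℤ ≤ d'
  Agree-nonneg equal 0≤d = 0≤d
  Agree-nonneg (above _ q) _ = ℤ.<⇒≤ (ℤ.≤-<-trans (+≤+ z≤n) q)
  Agree-nonneg (below p _) 0≤d = ⊥-elim (nonneg-below-absurd 0≤d p)

  Agree-nonpos : Agree k d d' → d ≤ 0ℤ → d' ≤ 0ℤ
  Agree-nonpos {d' = d'} ag d≤0 =
    subst (_≤ 0ℤ) (ℤ.neg-involutive d') (ℤ.neg-mono-≤ (Agree-nonneg (Agree-neg ag) (ℤ.neg-mono-≤ d≤0)))

  private
    shifted-above : - + k ≤ e → + (k ℕ.+ r) < d → + r < e + d
    shifted-above {k = k} {e = e} {r = r} {d = d} lo p = subst (_< e + d) cancel (ℤ.+-mono-≤-< lo p)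
      where
      cancel : - + k + + (k ℕ.+ r) ≡ + r
      cancel = trans (cong (λ n → - + k + n) (ℤ.pos-+ k r)) (ring (+ k) (+ r))
        where ring : ∀ k r → - k + (k + r) ≡ r
              ring = solve-∀

  Agree-shift : Agree (k ℕ.+ r) d d' → - + k ≤ e → e ≤ + k → Agree r (e + d) (e + d')
  Agree-shift equal _ _ = equal
  Agree-shift (above p q) lo _ = above (shifted-above lo p) (shifted-above lo q)
  Agree-shift {d = d} {d'} {e} (below p q) _ hi =
    below (subst (_ <_) (sym (ℤ.neg-distrib-+ e d)) (shifted-above (ℤ.neg-mono-≤ hi) p))
          (subst (_ <_) (sym (ℤ.neg-distrib-+ e d')) (shifted-above (ℤ.neg-mono-≤ hi) q))

  diff-suc : ∀ m n → diff (suc m) (suc n) ≡ diff m n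
  diff-suc m n = trans (ℤ.[1+m]⊖[1+n]≡m⊖n m n) (sym (ℤ.m-n≡m⊖n m n))

  diff-comm : ∀ m n → diff m n ≡ - diff n m
  diff-comm m n = ring (+ m) (+ n)
    where ring : ∀ m n → m - n ≡ - (n - m)
          ring = solve-∀

  diff-self : ∀ m → diff m m ≡ 0ℤ
  diff-self m = ℤ.+-inverseʳ (+ m)

  order : ℤ → OType
  order +0 = eqT
  order +[1+ _ ] = gtT
  order -[1+ _ ] = ltT

  otype≡order-diff : ∀ m n → otype m n ≡ order (diff m n)
  otype≡order-diff zero zero = refl
  otype≡order-diff zero (suc n) = refl
  otype≡order-diff (suc m) zero = refl
  otype≡order-diff (suc m) (suc n) = trans (otype≡order-diff m n) (cong order (sym (diff-suc m n)))

  ∣-∣≡∣diff∣ : ∀ m n → ∣ m - n ∣ ≡ ℤ.∣ diff m n ∣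
  ∣-∣≡∣diff∣ zero zero = refl
  ∣-∣≡∣diff∣ zero (suc n) = refl
  ∣-∣≡∣diff∣ (suc m) zero = cong suc (sym (ℕ.+-identityʳ m))
  ∣-∣≡∣diff∣ (suc m) (suc n) = trans (∣-∣≡∣diff∣ m n) (cong ℤ.∣_∣ (sym (diff-suc m n)))

  Distinguishable : ℕ → ℤ → ℤ → Set
  Distinguishable k d d' = order d ≢ order d' ⊎ (ℤ.∣ d ∣ ⊓ ℤ.∣ d' ∣ ℕ.≤ k × d ≢ d')

  distinguishable⇔ : ∀ k m n m' n' →
    (otype m n ≢ otype m' n' ⊎ (∣ m - n ∣ ⊓ ∣ m' - n' ∣ ℕ.≤ k × diff m n ≢ diff m' n'))
    ⇔ Distinguishable k (diff m n) (diff m' n')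
  distinguishable⇔ k m n m' n'
    rewrite otype≡order-diff m n | otype≡order-diff m' n' | ∣-∣≡∣diff∣ m n | ∣-∣≡∣diff∣ m' n' = mk⇔ id id

  private
    order-above : + k < d → order d ≡ gtT
    order-above {d = +0} (+<+ ())
    order-above {d = +[1+ _ ]} _ = refl

    order-below : + k < - d → order d ≡ ltT
    order-below {d = +0} (+<+ ())
    order-below {d = -[1+ _ ]} _ = refl

    ∣∣-above : + k < d → k ℕ.< ℤ.∣ d ∣
    ∣∣-above (+<+ k<n) = k<n

    ∣∣-below : + k < - d → k ℕ.< ℤ.∣ d ∣
    ∣∣-below {d = d} p = subst (_ ℕ.<_) (ℤ.∣-i∣≡∣i∣ d) (∣∣-above p)

    min-above : ∀ {m n} → k ℕ.< m → k ℕ.< n → ¬ (m ⊓ n ℕ.≤ k)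
    min-above p q le = ℕ.<⇒≱ (ℕ.⊓-glb p q) le

  Agree-order : Agree k d d' → order d ≡ order d'
  Agree-order equal = refl
  Agree-order (above p q) = trans (order-above p) (sym (order-above q))
  Agree-order (below p q) = trans (order-below p) (sym (order-below q))

  Agree-fixed : Agree k d d' → ℤ.∣ d ∣ ℕ.≤ k → d' ≡ d
  Agree-fixed equal _ = refl
  Agree-fixed (above p _) ∣d∣≤k = contradiction ∣d∣≤k (ℕ.<⇒≱ (∣∣-above p))
  Agree-fixed (below p _) ∣d∣≤k = contradiction ∣d∣≤k (ℕ.<⇒≱ (∣∣-below p))

  agree⇒¬distinguishable : Agree k d d' → ¬ Distinguishable k d d'
  agree⇒¬distinguishable ag (inj₁ ≢order) = ≢order (Agree-order ag)
  agree⇒¬distinguishable equal (inj₂ (_ , d≢d)) = d≢d refl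
  agree⇒¬distinguishable (above p q) (inj₂ (le , _)) = min-above (∣∣-above p) (∣∣-above q) le
  agree⇒¬distinguishable (below p q) (inj₂ (le , _)) = min-above (∣∣-below p) (∣∣-below q) le

  agree-or-distinguishable : ∀ k d d' → Agree k d d' ⊎ Distinguishable k d d'
  agree-or-distinguishable k +0 +0 = inj₁ equal
  agree-or-distinguishable k +0 +[1+ _ ] = inj₂ (inj₁ λ ())
  agree-or-distinguishable k +0 -[1+ _ ] = inj₂ (inj₁ λ ())
  agree-or-distinguishable k +[1+ _ ] +0 = inj₂ (inj₁ λ ())
  agree-or-distinguishable k +[1+ _ ] -[1+ _ ] = inj₂ (inj₁ λ ())
  agree-or-distinguishable k -[1+ _ ] +0 = inj₂ (inj₁ λ ())
  agree-or-distinguishable k -[1+ _ ] +[1+ _ ] = inj₂ (inj₁ λ ())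
  agree-or-distinguishable k +[1+ m ] +[1+ n ] with m ℕ.≟ n | suc m ⊓ suc n ℕ.≤? k
  ... | yes refl | _ = inj₁ equal
  ... | no m≢n | yes le = inj₂ (inj₂ (le , λ { refl → m≢n refl }))
  ... | no _ | no gt = inj₁ (above (+<+ (ℕ.<-≤-trans (ℕ.≰⇒> gt) (ℕ.m⊓n≤m _ _)))
                                  (+<+ (ℕ.<-≤-trans (ℕ.≰⇒> gt) (ℕ.m⊓n≤n _ _))))
  agree-or-distinguishable k -[1+ m ] -[1+ n ] with m ℕ.≟ n | suc m ⊓ suc n ℕ.≤? k
  ... | yes refl | _ = inj₁ equal
  ... | no m≢n | yes le = inj₂ (inj₂ (le , λ { refl → m≢n refl }))
  ... | no _ | no gt = inj₁ (below (+<+ (ℕ.<-≤-trans (ℕ.≰⇒> gt) (ℕ.m⊓n≤m _ _)))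
                                  (+<+ (ℕ.<-≤-trans (ℕ.≰⇒> gt) (ℕ.m⊓n≤n _ _))))

  GapAtom : Rel → ℤ → Set
  GapAtom lt d = order d ≡ ltT
  GapAtom eq d = d ≡ 0ℤ
  GapAtom sc d = d ≡ - 1ℤ

  Agree-GapAtom : ∀ ρ → Agree 1 d d' → GapAtom ρ d → GapAtom ρ d'
  Agree-GapAtom lt ag o = trans (sym (Agree-order ag)) o
  Agree-GapAtom eq ag refl = Agree-fixed ag z≤n
  Agree-GapAtom sc ag refl = Agree-fixed ag ℕ.≤-refl

  private
    <⇒otype≡ltT : ∀ {m n} → m ℕ.< n → otype m n ≡ ltT
    <⇒otype≡ltT {zero} {suc n} _ = refl
    <⇒otype≡ltT {suc m} {suc n} (s≤s m<n) = <⇒otype≡ltT m<n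

    otype≡ltT⇒< : ∀ m n → otype m n ≡ ltT → m ℕ.< n
    otype≡ltT⇒< zero (suc n) _ = s≤s z≤n
    otype≡ltT⇒< (suc m) (suc n) o = s≤s (otype≡ltT⇒< m n o)

    diff≡0⇒≡ : ∀ m n → diff m n ≡ 0ℤ → m ≡ n
    diff≡0⇒≡ zero zero _ = refl
    diff≡0⇒≡ (suc m) (suc n) e = cong suc (diff≡0⇒≡ m n (trans (sym (diff-suc m n)) e))

    diff-sucˡ : ∀ m n → diff (suc m) n ≡ 1ℤ + diff m n
    diff-sucˡ m n = ring (+ m) (+ n)
      where ring : ∀ m n → (1ℤ + m) - n ≡ 1ℤ + (m - n)
            ring = solve-∀

    diff-suc-self : ∀ m → diff m (suc m) ≡ - 1ℤ
    diff-suc-self m = ring (+ m)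
      where ring : ∀ m → m - (1ℤ + m) ≡ - 1ℤ
            ring = solve-∀

  atom⇔GapAtom : ∀ ρ I u u' → I ⊨ atom ρ u u' ⇔ GapAtom ρ (diff (val I u) (val I u'))
  atom⇔GapAtom lt I u u' =
    mk⇔ (λ m<n → trans (sym (otype≡order-diff m n)) (<⇒otype≡ltT m<n))
        (λ o → otype≡ltT⇒< m n (trans (otype≡order-diff m n) o))
    where m = val I u ; n = val I u'
  atom⇔GapAtom eq I u u' = mk⇔ (λ m≡n → trans (cong (diff m) (sym m≡n)) (diff-self m)) (diff≡0⇒≡ m n)
    where m = val I u ; n = val I u'
  atom⇔GapAtom sc I u u' =
    mk⇔ (λ 1+m≡n → trans (cong (diff m) (sym 1+m≡n)) (diff-suc-self m))
        (λ e → diff≡0⇒≡ (suc m) n (trans (diff-sucˡ m n) (cong (_+_ 1ℤ) e)))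
    where m = val I u ; n = val I u'

  <-cong-diff : ∀ {i j i' j'} → i < j → j - i ≡ j' - i' → i' < j'
  <-cong-diff {i} {j} {i'} {j'} i<j gaps =
    ℤ.suc[i]≤j⇒i<j (ℤ.0≤i-j⇒j≤i (subst (0ℤ ≤_) shifted (ℤ.i≤j⇒0≤j-i (ℤ.i<j⇒suc[i]≤j i<j))))
    where
    ring : ∀ j i → j - (1ℤ + i) ≡ (j - i) - 1ℤ
    ring = solve-∀
    shifted : j - sucℤ i ≡ j' - sucℤ i'
    shifted = trans (ring j i) (trans (cong (_- 1ℤ) gaps) (sym (ring j' i')))

  +[m+n+1] : ∀ m n → + (m ℕ.+ n ℕ.+ 1) ≡ + m + + n + 1ℤ
  +[m+n+1] m n = trans (ℤ.pos-+ (m ℕ.+ n) 1) (cong (_+ 1ℤ) (ℤ.pos-+ m n))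

  -- Points t lie at pI t on one line and at pJ t on another, and pairs of points agree with
  -- margin r s + r t + 1.  A new point a on the first line gets a partner b on the second
  -- agreeing with every t up to r t: if a lies within r t of some t, put b at the same offset
  -- from pJ t; otherwise put b just past the largest reach pJ t + r t of a point t left of a
  -- (the anchor o, not right of a, ensures there is one).
  module _ {P : Set} (L : List P) (pI pJ : P → ℤ) (r : P → ℕ)
           (agree : ∀ {s t} → s ∈ L → t ∈ L → Agree (r s ℕ.+ r t ℕ.+ 1) (pI s - pI t) (pJ s - pJ t))
           (a : ℤ) where

    private
      offset : P → ℤ
      offset t = a - pI t

      Close Left Right : P → Set
      Close t = - + r t ≤ offset t × offset t ≤ + r t
      Left t = + r t < offset t
      Right t = + r t < - offset t

      close? : ∀ t → Dec (Close t)
      close? t = (- + r t ℤ.≤? offset t) ×-dec (offset t ℤ.≤? + r t)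

      left? : ∀ t → Dec (Left t)
      left? t = + r t ℤ.<? offset t

      position : ∀ t → Close t ⊎ Left t ⊎ Right t
      position t with left? t | + r t ℤ.<? - offset t
      ... | yes l | _ = inj₂ (inj₁ l)
      ... | no _ | yes rt = inj₂ (inj₂ rt)
      ... | no ¬l | no ¬r =
        inj₁ (subst (- + r t ≤_) (ℤ.neg-involutive (offset t)) (ℤ.neg-mono-≤ (ℤ.≮⇒≥ ¬r)) , ℤ.≮⇒≥ ¬l)

      Extension : Set
      Extension = Σ ℤ λ b → ∀ {t} → t ∈ L → Agree (r t) (offset t) (b - pJ t)

      close-extension : ∀ {t} → t ∈ L → Close t → Extension
      close-extension {t} t∈ (lo , hi) = pJ t + offset t , λ {s} s∈ →
        subst₂ (Agree (r s)) (ringI a (pI t) (pI s)) (ringJ (pJ t) (offset t) (pJ s))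
               (Agree-shift (Agree-mono (ℕ.m≤m+n _ 1) (agree t∈ s∈)) lo hi)
        where
        ringI : ∀ a i j → (a - i) + (i - j) ≡ a - j
        ringI = solve-∀
        ringJ : ∀ i e j → e + (i - j) ≡ (i + e) - j
        ringJ = solve-∀

      reach : P → ℤ
      reach t = pJ t + + r t

      past-reach : ∀ {t t*} → reach t ≤ reach t* → + r t < sucℤ (reach t*) - pJ t
      past-reach {t} {t*} reach≤ =
        <-cong-diff (ℤ.suc[i]≤j⇒i<j (ℤ.suc-mono reach≤)) (ring (pJ t*) (+ r t*) (pJ t) (+ r t))
        where ring : ∀ i* r* i r → (1ℤ + (i* + r*)) - (i + r) ≡ ((1ℤ + (i* + r*)) - i) - r
              ring = solve-∀

      before-right : ∀ {t t*} → t ∈ L → t* ∈ L → Right t → Left t* → + r t < - (sucℤ (reach t*) - pJ t)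
      before-right {t} {t*} t∈ t*∈ rt lt* =
        <-cong-diff (Agree-beyond (agree t∈ t*∈) apart)
                    (trans (cong (_-_ (pJ t - pJ t*)) (+[m+n+1] (r t) (r t*))) (ring (pJ t) (pJ t*) (+ r t) (+ r t*)))
        where
        ringL : ∀ r r* → (1ℤ + r) + r* ≡ r + r* + 1ℤ
        ringL = solve-∀
        ringR : ∀ a i i* → - (a - i) + (a - i*) ≡ i - i*
        ringR = solve-∀
        apart : + (r t ℕ.+ r t* ℕ.+ 1) < pI t - pI t*
        apart = subst₂ _<_ (trans (ringL (+ r t) (+ r t*)) (sym (+[m+n+1] (r t) (r t*)))) (ringR a (pI t) (pI t*))
                       (ℤ.+-mono-≤-< (ℤ.i<j⇒suc[i]≤j rt) lt*)
        ring : ∀ i i* r r* → (i - i*) - (r + r* + 1ℤ) ≡ - ((1ℤ + (i* + r*)) - i) - r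
        ring = solve-∀

      far-extension : (∀ {t} → t ∈ L → ¬ Close t) → ∀ {o} → o ∈ L → pI o ≤ a → Extension
      far-extension none {o} o∈ o≤a = sucℤ (reach t*) , target
        where
        t* : P
        t* = argmax reach o (filter left? L)

        o-left : Left o
        o-left with position o
        ... | inj₁ c = ⊥-elim (none o∈ c)
        ... | inj₂ (inj₁ l) = l
        ... | inj₂ (inj₂ rt) = ⊥-elim (nonneg-below-absurd (ℤ.i≤j⇒0≤j-i o≤a) rt)

        t*-left : t* ∈ L × Left t*
        t*-left with argmax-sel reach o (filter left? L)
        ... | inj₁ t*≡o = subst (λ t → t ∈ L × Left t) (sym t*≡o) (o∈ , o-left)
        ... | inj₂ t*∈ = ∈-filter⁻ left? t*∈

        target : ∀ {t} → t ∈ L → Agree (r t) (offset t) (sucℤ (reach t*) - pJ t)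
        target {t} t∈ with position t
        ... | inj₁ c = ⊥-elim (none t∈ c)
        ... | inj₂ (inj₁ l) =
          above l (past-reach (All.lookup (f[xs]≤f[argmax] {f = reach} o (filter left? L)) (∈-filter⁺ left? t∈ l)))
        ... | inj₂ (inj₂ rt) = below rt (before-right t∈ (proj₁ t*-left) rt (proj₂ t*-left))

    extend : ∀ {o} → o ∈ L → pI o ≤ a → Σ ℤ λ b → ∀ {t} → t ∈ L → Agree (r t) (a - pI t) (b - pJ t)
    extend o∈ o≤a with any? close? L
    ... | yes some = let (t , t∈ , c) = find some in close-extension t∈ c
    ... | no none = far-extension (λ t∈ c → none (lose t∈ c)) o∈ o≤a

_≟V_ : (u v : Var) → Dec (u ≡ v)
x ≟V x = yes refl
x ≟V y = no λ ()
x ≟V z = no λ ()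
y ≟V x = no λ ()
y ≟V y = yes refl
y ≟V z = no λ ()
z ≟V x = no λ ()
z ≟V y = no λ ()
z ≟V z = yes refl

_≟T_ : (s t : Term) → Dec (s ≡ t)
mn ≟T mn = yes refl
mn ≟T mx = no λ ()
mn ≟T var _ = no λ ()
mx ≟T mn = no λ ()
mx ≟T mx = yes refl
mx ≟T var _ = no λ ()
var _ ≟T mn = no λ ()
var _ ≟T mx = no λ ()
var u ≟T var v = map′ (cong var) (λ { refl → refl }) (u ≟V v)

allTerms : List Term
allTerms = mn ∷ mx ∷ var x ∷ var y ∷ var z ∷ []

∈-allTerms : ∀ t → t ∈ allTerms
∈-allTerms mn = here refl
∈-allTerms mx = there (here refl)
∈-allTerms (var x) = there (there (here refl))
∈-allTerms (var y) = there (there (there (here refl)))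
∈-allTerms (var z) = there (there (there (there (here refl))))

allPairs : List Pair
allPairs = mnmx ∷ mnx ∷ mny ∷ mnz ∷ mxx ∷ mxy ∷ mxz ∷ xy ∷ xz ∷ yz ∷ []

∈-allPairs : ∀ p → p ∈ allPairs
∈-allPairs mnmx = here refl
∈-allPairs mnx = there (here refl)
∈-allPairs mny = there (there (here refl))
∈-allPairs mnz = there (there (there (here refl)))
∈-allPairs mxx = there (there (there (there (here refl))))
∈-allPairs mxy = there (there (there (there (there (here refl)))))
∈-allPairs mxz = there (there (there (there (there (there (here refl))))))
∈-allPairs xy = there (there (there (there (there (there (there (here refl)))))))
∈-allPairs xz = there (there (there (there (there (there (there (there (here refl))))))))
∈-allPairs yz = there (there (there (there (there (there (there (there (there (here refl)))))))))

-- The pair {s, t}; the last clause is a junk value for s ≡ t.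
pairOf : Term → Term → Pair
pairOf mn mx = mnmx
pairOf mn (var x) = mnx
pairOf mn (var y) = mny
pairOf mn (var z) = mnz
pairOf mx mn = mnmx
pairOf mx (var x) = mxx
pairOf mx (var y) = mxy
pairOf mx (var z) = mxz
pairOf (var x) mn = mnx
pairOf (var y) mn = mny
pairOf (var z) mn = mnz
pairOf (var x) mx = mxx
pairOf (var y) mx = mxy
pairOf (var z) mx = mxz
pairOf (var x) (var y) = xy
pairOf (var x) (var z) = xz
pairOf (var y) (var x) = xy
pairOf (var y) (var z) = yz
pairOf (var z) (var x) = xz
pairOf (var z) (var y) = yz
pairOf _ _ = mnmx

pairOf-ends : ∀ p → pairOf (proj₁ (ends p)) (proj₂ (ends p)) ≡ p
pairOf-ends mnmx = refl
pairOf-ends mnx = refl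
pairOf-ends mny = refl
pairOf-ends mnz = refl
pairOf-ends mxx = refl
pairOf-ends mxy = refl
pairOf-ends mxz = refl
pairOf-ends xy = refl
pairOf-ends xz = refl
pairOf-ends yz = refl

ends-distinct : ∀ p → proj₁ (ends p) ≢ proj₂ (ends p)
ends-distinct mnmx ()
ends-distinct mnx ()
ends-distinct mny ()
ends-distinct mnz ()
ends-distinct mxx ()
ends-distinct mxy ()
ends-distinct mxz ()
ends-distinct xy ()
ends-distinct xz ()
ends-distinct yz ()

pairOf-comm : ∀ s t → pairOf s t ≡ pairOf t s
pairOf-comm mn mn = refl
pairOf-comm mn mx = refl
pairOf-comm mn (var x) = refl
pairOf-comm mn (var y) = refl
pairOf-comm mn (var z) = refl
pairOf-comm mx mn = refl
pairOf-comm mx mx = refl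
pairOf-comm mx (var x) = refl
pairOf-comm mx (var y) = refl
pairOf-comm mx (var z) = refl
pairOf-comm (var x) mn = refl
pairOf-comm (var x) mx = refl
pairOf-comm (var x) (var x) = refl
pairOf-comm (var x) (var y) = refl
pairOf-comm (var x) (var z) = refl
pairOf-comm (var y) mn = refl
pairOf-comm (var y) mx = refl
pairOf-comm (var y) (var x) = refl
pairOf-comm (var y) (var y) = refl
pairOf-comm (var y) (var z) = refl
pairOf-comm (var z) mn = refl
pairOf-comm (var z) mx = refl
pairOf-comm (var z) (var x) = refl
pairOf-comm (var z) (var y) = refl
pairOf-comm (var z) (var z) = refl

ends-pairOf : ∀ s t → s ≢ t → ends (pairOf s t) ≡ (s , t) ⊎ ends (pairOf s t) ≡ (t , s)
ends-pairOf mn mn s≢t = contradiction refl s≢t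
ends-pairOf mn mx _ = inj₁ refl
ends-pairOf mn (var x) _ = inj₁ refl
ends-pairOf mn (var y) _ = inj₁ refl
ends-pairOf mn (var z) _ = inj₁ refl
ends-pairOf mx mn _ = inj₂ refl
ends-pairOf mx mx s≢t = contradiction refl s≢t
ends-pairOf mx (var x) _ = inj₁ refl
ends-pairOf mx (var y) _ = inj₁ refl
ends-pairOf mx (var z) _ = inj₁ refl
ends-pairOf (var x) mn _ = inj₂ refl
ends-pairOf (var y) mn _ = inj₂ refl
ends-pairOf (var z) mn _ = inj₂ refl
ends-pairOf (var x) mx _ = inj₂ refl
ends-pairOf (var y) mx _ = inj₂ refl
ends-pairOf (var z) mx _ = inj₂ refl
ends-pairOf (var x) (var x) s≢t = contradiction refl s≢t
ends-pairOf (var x) (var y) _ = inj₁ refl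
ends-pairOf (var x) (var z) _ = inj₁ refl
ends-pairOf (var y) (var x) _ = inj₂ refl
ends-pairOf (var y) (var y) s≢t = contradiction refl s≢t
ends-pairOf (var y) (var z) _ = inj₁ refl
ends-pairOf (var z) (var x) _ = inj₂ refl
ends-pairOf (var z) (var y) _ = inj₂ refl
ends-pairOf (var z) (var z) s≢t = contradiction refl s≢t

val-update-var : ∀ I v a (a≤N : a ℕ.≤ N I) → val (update I v a a≤N) (var v) ≡ a
val-update-var (mkI _ _ _ _ _ _ _) x a a≤N = refl
val-update-var (mkI _ _ _ _ _ _ _) y a a≤N = refl
val-update-var (mkI _ _ _ _ _ _ _) z a a≤N = refl

val-update-other : ∀ I v a (a≤N : a ℕ.≤ N I) t → t ≢ var v → val (update I v a a≤N) t ≡ val I t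
val-update-other (mkI _ _ _ _ _ _ _) _ _ _ mn _ = refl
val-update-other (mkI _ _ _ _ _ _ _) x _ _ mx _ = refl
val-update-other (mkI _ _ _ _ _ _ _) y _ _ mx _ = refl
val-update-other (mkI _ _ _ _ _ _ _) z _ _ mx _ = refl
val-update-other (mkI _ _ _ _ _ _ _) x _ _ (var x) t≢v = contradiction refl t≢v
val-update-other (mkI _ _ _ _ _ _ _) x _ _ (var y) _ = refl
val-update-other (mkI _ _ _ _ _ _ _) x _ _ (var z) _ = refl
val-update-other (mkI _ _ _ _ _ _ _) y _ _ (var x) _ = refl
val-update-other (mkI _ _ _ _ _ _ _) y _ _ (var y) t≢v = contradiction refl t≢v
val-update-other (mkI _ _ _ _ _ _ _) y _ _ (var z) _ = refl
val-update-other (mkI _ _ _ _ _ _ _) z _ _ (var x) _ = refl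
val-update-other (mkI _ _ _ _ _ _ _) z _ _ (var y) _ = refl
val-update-other (mkI _ _ _ _ _ _ _) z _ _ (var z) t≢v = contradiction refl t≢v

others : Var → List Term
others v = filter (λ t → ¬? (t ≟T var v)) allTerms

∈-others⁺ : ∀ {v t} → t ≢ var v → t ∈ others v
∈-others⁺ {v} {t} t≢v = ∈-filter⁺ (λ t → ¬? (t ≟T var v)) (∈-allTerms t) t≢v

∈-others⁻ : ∀ {v t} → t ∈ others v → t ≢ var v
∈-others⁻ {v} t∈ = proj₂ (∈-filter⁻ (λ t → ¬? (t ≟T var v)) {xs = allTerms} t∈)

-- Indistinguishability

gap : Interp → Term → Term → ℤ
gap I s t = diff (val I s) (val I t)

gapAt : Interp → Pair → ℤ
gapAt I p = gap I (proj₁ (ends p)) (proj₂ (ends p))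

-- The negation of `SepAt`, stated positively.
data Indist (δ : PotSep) (I J : Interp) (p : Pair) : Set where
  unconstrained : δ p ≡ 0 → Indist δ I J p
  agreeing : Agree (δ p) (gapAt I p) (gapAt J p) → Indist δ I J p

private
  variable
    δ δ' : PotSep
    I J : Interp
    p : Pair

sepAt⇔ : ∀ δ I J p → SepAt δ I J p ⇔ (1 ℕ.≤ δ p × Distinguishable (δ p) (gapAt I p) (gapAt J p))
sepAt⇔ δ I J p = mk⇔ (λ (δp≥1 , sep) → δp≥1 , Equivalence.to dist⇔ sep)
                     (λ (δp≥1 , dist) → δp≥1 , Equivalence.from dist⇔ dist)
  where
  ends₁ = proj₁ (ends p) ; ends₂ = proj₂ (ends p)
  dist⇔ = distinguishable⇔ (δ p) (val I ends₁) (val I ends₂) (val J ends₁) (val J ends₂)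

sepAt-or-indist : ∀ δ I J p → SepAt δ I J p ⊎ Indist δ I J p
sepAt-or-indist δ I J p with 1 ℕ.≤? δ p
... | no δp≱1 = inj₂ (unconstrained (ℕ.n<1⇒n≡0 (ℕ.≰⇒> δp≱1)))
... | yes δp≥1 with agree-or-distinguishable (δ p) (gapAt I p) (gapAt J p)
...   | inj₁ ag = inj₂ (agreeing ag)
...   | inj₂ dist = inj₁ (Equivalence.from (sepAt⇔ δ I J p) (δp≥1 , dist))

indist⇒¬sepAt : Indist δ I J p → ¬ SepAt δ I J p
indist⇒¬sepAt {δ} {I} {J} {p} ind sep with Equivalence.to (sepAt⇔ δ I J p) sep | ind
... | δp≥1 , _ | unconstrained δp≡0 = ℕ.<⇒≢ δp≥1 (sym δp≡0)
... | _ , dist | agreeing ag = agree⇒¬distinguishable ag dist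

¬sepAt⇒indist : ∀ δ I J p → ¬ SepAt δ I J p → Indist δ I J p
¬sepAt⇒indist δ I J p ¬sep = [ ⊥-elim ∘ ¬sep , id ]′ (sepAt-or-indist δ I J p)

¬indist⇒sepAt : ∀ δ I J p → ¬ Indist δ I J p → SepAt δ I J p
¬indist⇒sepAt δ I J p ¬ind = [ id , ⊥-elim ∘ ¬ind ]′ (sepAt-or-indist δ I J p)

Indist-sym : Indist δ I J p → Indist δ J I p
Indist-sym (unconstrained δp≡0) = unconstrained δp≡0
Indist-sym (agreeing ag) = agreeing (Agree-sym ag)

Indist-mono : δ p ℕ.≤ δ' p → Indist δ' I J p → Indist δ I J p
Indist-mono δ≤δ' (unconstrained δ'p≡0) = unconstrained (ℕ.n≤0⇒n≡0 (subst (_ ℕ.≤_) δ'p≡0 δ≤δ'))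
Indist-mono δ≤δ' (agreeing ag) = agreeing (Agree-mono δ≤δ' ag)

SepAt-sym : ∀ δ I J p → SepAt δ I J p → SepAt δ J I p
SepAt-sym δ I J p sep = ¬indist⇒sepAt δ J I p λ ind → indist⇒¬sepAt (Indist-sym ind) sep

SepAt-mono : ∀ {δ δ'} I J p → δ p ℕ.≤ δ' p → SepAt δ I J p → SepAt δ' I J p
SepAt-mono {δ} {δ'} I J p δ≤δ' sep =
  ¬indist⇒sepAt δ' I J p λ ind → indist⇒¬sepAt (Indist-mono {δ = δ} δ≤δ' ind) sep

sepAt? : ∀ δ I J p → Dec (SepAt δ I J p)
sepAt? δ I J p = [ yes , no ∘ indist⇒¬sepAt ]′ (sepAt-or-indist δ I J p)

separator-criterion : ∀ {A B : Pred} {δ} →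
  (∀ {I J} → A I → B J → (∀ p → Indist δ I J p) → ⊥) → IsSeparator (A , B) δ
separator-criterion {δ = δ} never I J AI BJ with any? (sepAt? δ I J) allPairs
... | yes some = satisfied some
... | no none = ⊥-elim (never AI BJ λ p → ¬sepAt⇒indist δ I J p (none ∘ lose (∈-allPairs p)))

gap-swap : ∀ I s t → gap I t s ≡ - gap I s t
gap-swap I s t = diff-comm (val I t) (val I s)

private
  Agree-ends : ∀ {k s t} → ends p ≡ (s , t) →
    Agree k (gapAt I p) (gapAt J p) → Agree k (gap I s t) (gap J s t)
  Agree-ends refl ag = ag

Agree-pairOf : ∀ {k} s t → s ≢ t →
  Agree k (gapAt I (pairOf s t)) (gapAt J (pairOf s t)) → Agree k (gap I s t) (gap J s t)
Agree-pairOf {I} {J} {k} s t s≢t ag with ends-pairOf s t s≢t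
... | inj₁ e = Agree-ends e ag
... | inj₂ e = subst₂ (Agree k) (sym (gap-swap I t s)) (sym (gap-swap J t s)) (Agree-neg (Agree-ends e ag))

Indist⇒Agree : 1 ℕ.≤ δ p → Indist δ I J p → Agree (δ p) (gapAt I p) (gapAt J p)
Indist⇒Agree δp≥1 (unconstrained δp≡0) = contradiction (sym δp≡0) (ℕ.<⇒≢ δp≥1)
Indist⇒Agree _ (agreeing ag) = ag

Indist-ends : Agree (δ (pairOf (proj₁ (ends p)) (proj₂ (ends p)))) (gapAt I p) (gapAt J p) → Indist δ I J p
Indist-ends {δ} {p} {I} {J} ag = agreeing (subst (λ q → Agree (δ q) (gapAt I p) (gapAt J p)) (pairOf-ends p) ag)

Indist-cong : ∀ {I' J'} → gapAt I p ≡ gapAt I' p → gapAt J p ≡ gapAt J' p → Indist δ I J p → Indist δ I' J' p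
Indist-cong _ _ (unconstrained δp≡0) = unconstrained δp≡0
Indist-cong eI eJ (agreeing ag) = agreeing (subst₂ (Agree _) eI eJ ag)

-- The separator at a quantifier node

touches : Var → Pair → Bool
touches v p = does (var v ≟T proj₁ (ends p)) ∨ does (var v ≟T proj₂ (ends p))

radius : Var → PotSep → Term → ℕ
radius v δ t = δ (pairOf (var v) t)

quantSep : Var → PotSep → PotSep
quantSep v δ p =
  if touches v p then 0 else δ p ⊔ (radius v δ (proj₁ (ends p)) ℕ.+ radius v δ (proj₂ (ends p)) ℕ.+ 1)

quantSep-untouched : ∀ v δ p → var v ≢ proj₁ (ends p) → var v ≢ proj₂ (ends p) →
  quantSep v δ p ≡ δ p ⊔ (radius v δ (proj₁ (ends p)) ℕ.+ radius v δ (proj₂ (ends p)) ℕ.+ 1)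
quantSep-untouched v δ p v≢e₁ v≢e₂
  rewrite dec-false (var v ≟T proj₁ (ends p)) v≢e₁ | dec-false (var v ≟T proj₂ (ends p)) v≢e₂ = refl

quantSep-ends : ∀ v δ p {e₁ e₂} → ends p ≡ (e₁ , e₂) → var v ≢ e₁ → var v ≢ e₂ →
  radius v δ e₁ ℕ.+ radius v δ e₂ ℕ.+ 1 ℕ.≤ quantSep v δ p
quantSep-ends v δ p refl v≢e₁ v≢e₂ =
  subst (radius v δ (proj₁ (ends p)) ℕ.+ radius v δ (proj₂ (ends p)) ℕ.+ 1 ℕ.≤_)
        (sym (quantSep-untouched v δ p v≢e₁ v≢e₂)) (ℕ.m≤n⊔m (δ p) _)

quantSep-pairOf : ∀ v δ s t → s ≢ var v → t ≢ var v → s ≢ t →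
  radius v δ s ℕ.+ radius v δ t ℕ.+ 1 ℕ.≤ quantSep v δ (pairOf s t)
quantSep-pairOf v δ s t s≢v t≢v s≢t with ends-pairOf s t s≢t
... | inj₁ e = quantSep-ends v δ (pairOf s t) e (s≢v ∘ sym) (t≢v ∘ sym)
... | inj₂ e = subst (λ n → n ℕ.+ 1 ℕ.≤ quantSep v δ (pairOf s t)) (ℕ.+-comm (radius v δ t) (radius v δ s))
                     (quantSep-ends v δ (pairOf s t) e (t≢v ∘ sym) (s≢v ∘ sym))

agree-others : ∀ v δ {I J} → (∀ p → Indist (quantSep v δ) I J p) → ∀ {s t} → s ∈ others v → t ∈ others v →
  Agree (radius v δ s ℕ.+ radius v δ t ℕ.+ 1) (gap I s t) (gap J s t)
agree-others v δ {I} {J} ind {s} {t} s∈ t∈ with s ≟T t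
... | yes refl = subst₂ (Agree _) (sym (diff-self (val I s))) (sym (diff-self (val J s))) equal
... | no s≢t = Agree-mono bound (Agree-pairOf s t s≢t (Indist⇒Agree (ℕ.≤-trans (ℕ.m≤n+m 1 _) bound) (ind (pairOf s t))))
  where bound = quantSep-pairOf v δ s t (∈-others⁻ s∈) (∈-others⁻ t∈) s≢t

module _ (v : Var) (δ : PotSep) {I J : Interp} {a b : ℕ} (a≤N : a ℕ.≤ N I) (b≤N : b ℕ.≤ N J)
         (agreed : ∀ {t} → t ∈ others v → Agree (radius v δ t) (diff a (val I t)) (diff b (val J t))) where
  private
    I' = update I v a a≤N
    J' = update J v b b≤N

  Agree-updated : ∀ t → t ≢ var v → Agree (δ (pairOf (var v) t)) (gap I' (var v) t) (gap J' (var v) t)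
  Agree-updated t t≢v =
    subst₂ (Agree _) (cong₂ diff (sym (val-update-var I v a a≤N)) (sym (val-update-other I v a a≤N t t≢v)))
                     (cong₂ diff (sym (val-update-var J v b b≤N)) (sym (val-update-other J v b b≤N t t≢v)))
           (agreed (∈-others⁺ {v} t≢v))

  Agree-updated-swap : ∀ t → t ≢ var v → Agree (δ (pairOf t (var v))) (gap I' t (var v)) (gap J' t (var v))
  Agree-updated-swap t t≢v =
    subst₂ (λ q g → Agree (δ q) g (gap J' t (var v))) (pairOf-comm (var v) t) (sym (gap-swap I' (var v) t))
      (subst (Agree _ (- gap I' (var v) t)) (sym (gap-swap J' (var v) t)) (Agree-neg (Agree-updated t t≢v)))

  indist-update : (∀ p → Indist (quantSep v δ) I J p) → ∀ p → Indist δ I' J' p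
  indist-update ind p with var v ≟T proj₁ (ends p) | var v ≟T proj₂ (ends p)
  ... | yes v≡e₁ | yes v≡e₂ = contradiction (trans (sym v≡e₁) v≡e₂) (ends-distinct p)
  ... | yes v≡e₁ | no v≢e₂ =
    Indist-ends (subst (λ s → Agree (δ (pairOf s e₂)) (gap I' s e₂) (gap J' s e₂)) v≡e₁ (Agree-updated e₂ (v≢e₂ ∘ sym)))
    where e₂ = proj₂ (ends p)
  ... | no v≢e₁ | yes v≡e₂ =
    Indist-ends (subst (λ t → Agree (δ (pairOf e₁ t)) (gap I' e₁ t) (gap J' e₁ t)) v≡e₂ (Agree-updated-swap e₁ (v≢e₁ ∘ sym)))
    where e₁ = proj₁ (ends p)
  ... | no v≢e₁ | no v≢e₂ =
    Indist-cong (cong₂ diff (unchanged I a≤N v≢e₁) (unchanged I a≤N v≢e₂)) (cong₂ diff (unchanged J b≤N v≢e₁) (unchanged J b≤N v≢e₂))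
                (Indist-mono (subst (δ p ℕ.≤_) (sym (quantSep-untouched v δ p v≢e₁ v≢e₂)) (ℕ.m≤m⊔n _ _)) (ind p))
    where unchanged : ∀ K {c} (c≤N : c ℕ.≤ N K) {t} → var v ≢ t → val K t ≡ val (update K v c c≤N) t
          unchanged K c≤N v≢t = sym (val-update-other K v _ c≤N _ (v≢t ∘ sym))

indist-extend : ∀ v δ {I J} → (∀ p → Indist (quantSep v δ) I J p) → ∀ a (a≤N : a ℕ.≤ N I) →
  Σ ℕ λ b → Σ (b ℕ.≤ N J) λ b≤N → ∀ p → Indist δ (update I v a a≤N) (update J v b b≤N) p
indist-extend v δ {I} {J} ind a a≤N =
  ℤ.∣ b ∣ , ∣b∣≤N , indist-update v δ a≤N ∣b∣≤N (λ t∈ → subst (Agree _ _) (cong (ℤ._- _) (sym ∣b∣≡b)) (agreed t∈)) ind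
  where
  mn∈ : mn ∈ others v
  mn∈ = ∈-others⁺ {v} λ ()

  mx∈ : mx ∈ others v
  mx∈ = ∈-others⁺ {v} λ ()

  extension = extend (others v) (λ t → + val I t) (λ t → + val J t) (radius v δ) (agree-others v δ ind) (+ a) mn∈ (+≤+ z≤n)
  b = proj₁ extension
  agreed = proj₂ extension

  0≤b : 0ℤ ℤ.≤ b
  0≤b = subst (0ℤ ℤ.≤_) (ℤ.+-identityʳ b) (Agree-nonneg (agreed mn∈) (+≤+ z≤n))

  ∣b∣≡b : + ℤ.∣ b ∣ ≡ b
  ∣b∣≡b = ℤ.0≤i⇒+∣i∣≡i 0≤b

  ∣b∣≤N : ℤ.∣ b ∣ ℕ.≤ N J
  ∣b∣≤N = ℤ.drop‿+≤+ (subst (ℤ._≤ + N J) (sym ∣b∣≡b) (ℤ.i-j≤0⇒i≤j (Agree-nonpos (agreed mx∈) (ℤ.i≤j⇒i-j≤0 (+≤+ a≤N)))))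

-- Weights

minPair maxPair : Var → Pair
minPair x = mnx
minPair y = mny
minPair z = mnz
maxPair x = mxx
maxPair y = mxy
maxPair z = mxz

_⊕_ : PotSep → PotSep → PotSep
(δ₁ ⊕ δ₂) p = δ₁ p ℕ.+ δ₂ p

module _ where
  open import Data.Nat using (_+_; _*_; _∸_; _≤_; _<_)
  open import Data.Nat.Properties
  open import Data.Nat.Tactic.RingSolver using (solve-∀)
  open import Algebra.Properties.CommutativeSemigroup +-commutativeSemigroup using (interchange)

  private
    ≤-⊔₃ : ∀ {f : Var → ℕ} u → f u ≤ f x ⊔ f y ⊔ f z
    ≤-⊔₃ {f} x = ≤-trans (m≤m⊔n (f x) (f y)) (m≤m⊔n _ (f z))
    ≤-⊔₃ {f} y = ≤-trans (m≤n⊔m (f x) (f y)) (m≤m⊔n _ (f z))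
    ≤-⊔₃ {f} z = m≤n⊔m (f x ⊔ f y) (f z)

    ⊔₃-lub : ∀ {f : Var → ℕ} {k} → (∀ u → f u ≤ k) → f x ⊔ f y ⊔ f z ≤ k
    ⊔₃-lub bound = ⊔-lub (⊔-lub (bound x) (bound y)) (bound z)

  -- cδ δ is definitionally the maximum of star δ u over u.
  star : PotSep → Var → ℕ
  star δ x = δ xy + δ xz
  star δ y = δ xy + δ yz
  star δ z = δ xz + δ yz

  star≤cδ : ∀ δ u → star δ u ≤ cδ δ
  star≤cδ δ = ≤-⊔₃ {star δ}

  cδ-lub : ∀ δ {k} → (∀ u → star δ u ≤ k) → cδ δ ≤ k
  cδ-lub δ = ⊔₃-lub {star δ}

  bδ-minmax : ∀ δ → δ mnmx ≤ bδ δ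
  bδ-minmax δ = m≤m⊔n (δ mnmx) _

  bδ-ends : ∀ δ u u' → δ (minPair u) + δ (maxPair u') ≤ bδ δ
  bδ-ends δ u u' = ≤-trans (≤-⊔₃ {λ u' → δ (minPair u) + δ (maxPair u')} u')
                  (≤-trans (≤-⊔₃ {⨆} u) (m≤n⊔m (δ mnmx) _))
    where ⨆ : Var → ℕ
          ⨆ u = (δ (minPair u) + δ mxx) ⊔ (δ (minPair u) + δ mxy) ⊔ (δ (minPair u) + δ mxz)

  bδ-lub : ∀ δ {k} → δ mnmx ≤ k → (∀ u u' → δ (minPair u) + δ (maxPair u') ≤ k) → bδ δ ≤ k
  bδ-lub δ mnmx≤k ends≤k = ⊔-lub mnmx≤k (⊔₃-lub λ u → ⊔₃-lub (ends≤k u))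

  cδ-⊕ : ∀ δ₁ δ₂ → cδ (δ₁ ⊕ δ₂) ≤ cδ δ₁ + cδ δ₂
  cδ-⊕ δ₁ δ₂ = cδ-lub (δ₁ ⊕ δ₂) λ u → subst (_≤ cδ δ₁ + cδ δ₂) (star-⊕ u) (+-mono-≤ (star≤cδ δ₁ u) (star≤cδ δ₂ u))
    where
    star-⊕ : ∀ u → star δ₁ u + star δ₂ u ≡ star (δ₁ ⊕ δ₂) u
    star-⊕ x = interchange (δ₁ xy) (δ₁ xz) (δ₂ xy) (δ₂ xz)
    star-⊕ y = interchange (δ₁ xy) (δ₁ yz) (δ₂ xy) (δ₂ yz)
    star-⊕ z = interchange (δ₁ xz) (δ₁ yz) (δ₂ xz) (δ₂ yz)

  bδ-⊕ : ∀ δ₁ δ₂ → bδ (δ₁ ⊕ δ₂) ≤ bδ δ₁ + bδ δ₂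
  bδ-⊕ δ₁ δ₂ = bδ-lub (δ₁ ⊕ δ₂) (+-mono-≤ (bδ-minmax δ₁) (bδ-minmax δ₂)) λ u u' →
    subst (_≤ bδ δ₁ + bδ δ₂) (interchange (δ₁ (minPair u)) (δ₁ (maxPair u')) (δ₂ (minPair u)) (δ₂ (maxPair u')))
          (+-mono-≤ (bδ-ends δ₁ u u') (bδ-ends δ₂ u u'))

  cδ²≤W : ∀ δ → cδ δ * cδ δ ≤ W δ
  cδ²≤W δ = m≤m+n _ _

  W-⊕ : ∀ δ₁ δ₂ → W (δ₁ ⊕ δ₂) ≤ W δ₁ + W δ₂ + 2 * (cδ δ₁ * cδ δ₂)
  W-⊕ δ₁ δ₂ = ≤-trans (+-mono-≤ (*-mono-≤ (cδ-⊕ δ₁ δ₂) (cδ-⊕ δ₁ δ₂)) (bδ-⊕ δ₁ δ₂))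
                      (≤-reflexive (expand (cδ δ₁) (cδ δ₂) (bδ δ₁) (bδ δ₂)))
    where expand : ∀ c₁ c₂ b₁ b₂ → (c₁ + c₂) * (c₁ + c₂) + (b₁ + b₂) ≡ (c₁ * c₁ + b₁) + (c₂ * c₂ + b₂) + 2 * (c₁ * c₂)
          expand = solve-∀

  quantSep-mnmx : ∀ v δ → quantSep v δ mnmx ≡ δ mnmx ⊔ (δ (minPair v) + δ (maxPair v) + 1)
  quantSep-mnmx x δ = refl
  quantSep-mnmx y δ = refl
  quantSep-mnmx z δ = refl

  xy≤cδ : ∀ δ → δ xy ≤ cδ δ
  xy≤cδ δ = ≤-trans (m≤m+n (δ xy) (δ xz)) (star≤cδ δ x)

  xz≤cδ : ∀ δ → δ xz ≤ cδ δ
  xz≤cδ δ = ≤-trans (m≤n+m (δ xz) (δ xy)) (star≤cδ δ x)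

  yz≤cδ : ∀ δ → δ yz ≤ cδ δ
  yz≤cδ δ = ≤-trans (m≤n+m (δ yz) (δ xy)) (star≤cδ δ y)

  private
    grow : ∀ a m {i j} → i ≤ j → a ⊔ (m + i + 1) ≤ a ⊔ (m + j + 1)
    grow a m i≤j = ⊔-monoʳ-≤ a (+-monoˡ-≤ 1 (+-monoʳ-≤ m i≤j))

  quantSep-minPair : ∀ v δ u → quantSep v δ (minPair u) ≤ δ (minPair u) ⊔ (δ (minPair v) + cδ δ + 1)
  quantSep-minPair x δ x = z≤n
  quantSep-minPair x δ y = grow (δ mny) (δ mnx) (xy≤cδ δ)
  quantSep-minPair x δ z = grow (δ mnz) (δ mnx) (xz≤cδ δ)
  quantSep-minPair y δ x = grow (δ mnx) (δ mny) (xy≤cδ δ)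
  quantSep-minPair y δ y = z≤n
  quantSep-minPair y δ z = grow (δ mnz) (δ mny) (yz≤cδ δ)
  quantSep-minPair z δ x = grow (δ mnx) (δ mnz) (xz≤cδ δ)
  quantSep-minPair z δ y = grow (δ mny) (δ mnz) (yz≤cδ δ)
  quantSep-minPair z δ z = z≤n

  quantSep-maxPair : ∀ v δ u → quantSep v δ (maxPair u) ≤ δ (maxPair u) ⊔ (δ (maxPair v) + cδ δ + 1)
  quantSep-maxPair x δ x = z≤n
  quantSep-maxPair x δ y = grow (δ mxy) (δ mxx) (xy≤cδ δ)
  quantSep-maxPair x δ z = grow (δ mxz) (δ mxx) (xz≤cδ δ)
  quantSep-maxPair y δ x = grow (δ mxx) (δ mxy) (xy≤cδ δ)
  quantSep-maxPair y δ y = z≤n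
  quantSep-maxPair y δ z = grow (δ mxz) (δ mxy) (yz≤cδ δ)
  quantSep-maxPair z δ x = grow (δ mxx) (δ mxz) (xz≤cδ δ)
  quantSep-maxPair z δ y = grow (δ mxy) (δ mxz) (yz≤cδ δ)
  quantSep-maxPair z δ z = z≤n

  cδ-quantSep : ∀ v δ → cδ (quantSep v δ) ≤ cδ δ + 1
  cδ-quantSep x δ = cδ-lub (quantSep x δ) λ { x → z≤n ; y → opposite ; z → opposite }
    where opposite = ⊔-lub (≤-trans (yz≤cδ δ) (m≤m+n _ 1)) (+-monoˡ-≤ 1 (star≤cδ δ x))
  cδ-quantSep y δ = cδ-lub (quantSep y δ) λ { x → opposite ; y → z≤n ; z → subst (_≤ cδ δ + 1) (sym (+-identityʳ _)) opposite }
    where opposite = ⊔-lub (≤-trans (xz≤cδ δ) (m≤m+n _ 1)) (+-monoˡ-≤ 1 (star≤cδ δ y))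
  cδ-quantSep z δ = cδ-lub (quantSep z δ) λ { x → subst (_≤ cδ δ + 1) (sym (+-identityʳ _)) opposite
                                            ; y → subst (_≤ cδ δ + 1) (sym (+-identityʳ _)) opposite ; z → z≤n }
    where opposite = ⊔-lub (≤-trans (xy≤cδ δ) (m≤m+n _ 1)) (+-monoˡ-≤ 1 (star≤cδ δ z))

  private
    ⊔+⊔≤ : ∀ {a b c d k} → a + c ≤ k → a + d ≤ k → b + c ≤ k → b + d ≤ k → (a ⊔ b) + (c ⊔ d) ≤ k
    ⊔+⊔≤ {a} {b} {c} {d} {k} ac ad bc bd =
      subst (_≤ k) (sym (trans (+-distribʳ-⊔ (c ⊔ d) a b) (cong₂ _⊔_ (+-distribˡ-⊔ a c d) (+-distribˡ-⊔ b c d))))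
            (⊔-lub (⊔-lub ac ad) (⊔-lub bc bd))

  bδ-quantSep : ∀ v δ → bδ (quantSep v δ) ≤ bδ δ + 2 * (cδ δ + 1)
  bδ-quantSep v δ = bδ-lub (quantSep v δ) minmax λ u u' →
    ≤-trans (+-mono-≤ (quantSep-minPair v δ u) (quantSep-maxPair v δ u'))
            (⊔+⊔≤ {m u} {m v + c + 1} {M u'} {M v + c + 1}
                  (≤-trans (bδ-ends δ u u') (m≤m+n _ _))
                  (≤-trans (≤-reflexive (ring₁ (m u) (M v) c)) (+-mono-≤ (bδ-ends δ u v) c+1≤))
                  (≤-trans (≤-reflexive (ring₂ (m v) (M u') c)) (+-mono-≤ (bδ-ends δ v u') c+1≤))
                  (≤-trans (≤-reflexive (ring₃ (m v) (M v) c)) (+-monoˡ-≤ _ (bδ-ends δ v v))))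
    where
    c = cδ δ
    m M : Var → ℕ
    m u = δ (minPair u)
    M u = δ (maxPair u)
    c+1≤ : c + 1 ≤ 2 * (c + 1)
    c+1≤ = m≤m+n (c + 1) _
    ring₁ : ∀ a m c → a + (m + c + 1) ≡ (a + m) + (c + 1)
    ring₁ = solve-∀
    ring₂ : ∀ m a c → (m + c + 1) + a ≡ (m + a) + (c + 1)
    ring₂ = solve-∀
    ring₃ : ∀ m n c → (m + c + 1) + (n + c + 1) ≡ (m + n) + 2 * (c + 1)
    ring₃ = solve-∀
    minmax : quantSep v δ mnmx ≤ bδ δ + 2 * (c + 1)
    minmax = subst (_≤ bδ δ + 2 * (c + 1)) (sym (quantSep-mnmx v δ))
               (⊔-lub (≤-trans (bδ-minmax δ) (m≤m+n _ _)) (+-mono-≤ (bδ-ends δ v v) (≤-trans (m≤n+m 1 c) c+1≤)))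

  W-quantSep : ∀ v δ → W (quantSep v δ) ≤ W δ + 4 + 4 * cδ δ
  W-quantSep v δ = ≤-trans (+-mono-≤ (*-mono-≤ (cδ-quantSep v δ) (cδ-quantSep v δ)) (bδ-quantSep v δ))
                           (≤-trans (m≤m+n _ 1) (≤-reflexive (expand (cδ δ) (bδ δ))))
    where expand : ∀ c b → (c + 1) * (c + 1) + (b + 2 * (c + 1)) + 1 ≡ c * c + b + 4 + 4 * c
          expand = solve-∀

  SqrtLe-intro : ∀ {w m n} d → w ≤ m + n + d → d * d ≤ 4 * (m * n) → SqrtLe w m n
  SqrtLe-intro {w} {m} {n} d w≤ d²≤ with w ≤? m + n
  ... | yes w≤m+n = inj₁ w≤m+n
  ... | no w≰m+n = inj₂ (≰⇒> w≰m+n , ≤-trans (*-mono-≤ excess≤d excess≤d) d²≤)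
    where excess≤d : w ∸ (m + n) ≤ d
          excess≤d = subst (w ∸ (m + n) ≤_) (m+n∸m≡n (m + n) d) (∸-monoˡ-≤ (m + n) w≤)

  sqrtLe-⊕ : ∀ {w} δ₁ δ₂ → w ≤ W (δ₁ ⊕ δ₂) → SqrtLe w (W δ₁) (W δ₂)
  sqrtLe-⊕ δ₁ δ₂ w≤ = SqrtLe-intro {m = W δ₁} {W δ₂} (2 * (cδ δ₁ * cδ δ₂)) (≤-trans w≤ (W-⊕ δ₁ δ₂))
    (≤-trans (≤-reflexive (square (cδ δ₁) (cδ δ₂))) (*-monoʳ-≤ 4 (*-mono-≤ (cδ²≤W δ₁) (cδ²≤W δ₂))))
    where square : ∀ a b → (2 * (a * b)) * (2 * (a * b)) ≡ 4 * ((a * a) * (b * b))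
          square = solve-∀

  sqrtLe-quantSep : ∀ {w} v δ → w ≤ W (quantSep v δ) → SqrtLe w (W δ) 4
  sqrtLe-quantSep v δ w≤ = SqrtLe-intro {m = W δ} {4} (4 * cδ δ) (≤-trans w≤ (W-quantSep v δ))
    (≤-trans (≤-reflexive (square (cδ δ))) (*-monoʳ-≤ 4 (*-monoˡ-≤ 4 (cδ²≤W δ))))
    where square : ∀ a → (4 * a) * (4 * a) ≡ 4 * ((a * a) * 4)
          square = solve-∀

-- Separators at the nodes of a syntax tree

index : Pair → ℕ
index mnmx = 0
index mnx = 1
index mny = 2
index mnz = 3
index mxx = 4
index mxy = 5
index mxz = 6
index xy = 7
index xz = 8
index yz = 9

unit : Pair → PotSep
unit p q = if index p ℕ.≡ᵇ index q then 1 else 0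

unit-self : ∀ p → unit p p ≡ 1
unit-self mnmx = refl
unit-self mnx = refl
unit-self mny = refl
unit-self mnz = refl
unit-self mxx = refl
unit-self mxy = refl
unit-self mxz = refl
unit-self xy = refl
unit-self xz = refl
unit-self yz = refl

W-unit : ∀ p → W (unit p) ℕ.≤ 1
W-unit mnmx = ℕ.≤-refl
W-unit mnx = ℕ.≤-refl
W-unit mny = ℕ.≤-refl
W-unit mnz = ℕ.≤-refl
W-unit mxx = ℕ.≤-refl
W-unit mxy = ℕ.≤-refl
W-unit mxz = ℕ.≤-refl
W-unit xy = ℕ.≤-refl
W-unit xz = ℕ.≤-refl
W-unit yz = ℕ.≤-refl

-- Double negation on the A side: a ¬-node swaps the two sides.
_⊨±_ : Label → Form → Set
(A , B) ⊨± φ = (∀ I → A I → ¬ ¬ (I ⊨ φ)) × (∀ J → B J → ¬ (J ⊨ φ))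

atom-separator : ∀ {A B} ρ u u' → (A , B) ⊨± atom ρ u u' → Σ PotSep λ δ → IsSeparator (A , B) δ × W δ ℕ.≤ 1
atom-separator {A} {B} ρ u u' (hA , hB) with u ≟T u'
... | yes refl = (λ _ → 0) , separator-criterion (λ {I} {J} AI BJ _ → hA I AI λ hI → hB J BJ (constant I J hI)) , z≤n
  where
  constant : ∀ I J → I ⊨ atom ρ u u → J ⊨ atom ρ u u
  constant I J = Equivalence.from (atom⇔GapAtom ρ J u u)
               ∘ subst (GapAtom ρ) (trans (diff-self (val I u)) (sym (diff-self (val J u))))
               ∘ Equivalence.to (atom⇔GapAtom ρ I u u)
... | no u≢u' = unit q , separator-criterion never , W-unit q
  where
  q = pairOf u u'
  never : ∀ {I J} → A I → B J → (∀ q' → Indist (unit q) I J q') → ⊥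
  never {I} {J} AI BJ ind = hA I AI λ hI → hB J BJ (Equivalence.from (atom⇔GapAtom ρ J u u')
                                                     (Agree-GapAtom ρ agree (Equivalence.to (atom⇔GapAtom ρ I u u') hI)))
    where agree = subst (λ k → Agree k (gap I u u') (gap J u u')) (unit-self q)
                   (Agree-pairOf u u' u≢u' (Indist⇒Agree (ℕ.≤-reflexive (sym (unit-self q))) (ind q)))

IsSeparator-swap : ∀ {A B δ} → IsSeparator (B , A) δ → IsSeparator (A , B) δ
IsSeparator-swap {δ = δ} sep I J AI BJ = let (p , s) = sep J I BJ AI in p , SepAt-sym δ J I p s

∨-separator : ∀ {φ₁ φ₂ A B δ₁ δ₂} → (∀ I → A I → ¬ ¬ (I ⊨ (φ₁ ∨' φ₂))) →
  IsSeparator ((λ I → A I × (I ⊨ φ₁)) , B) δ₁ → IsSeparator ((λ I → A I × (I ⊨ φ₂)) , B) δ₂ →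
  IsSeparator (A , B) (δ₁ ⊕ δ₂)
∨-separator {δ₁ = δ₁} {δ₂} hA sep₁ sep₂ = separator-criterion λ {I} {J} AI BJ ind → hA I AI λ where
  (inj₁ h₁) → let (p , s) = sep₁ I J (AI , h₁) BJ in indist⇒¬sepAt (ind p) (SepAt-mono {δ₁} {δ₁ ⊕ δ₂} I J p (ℕ.m≤m+n (δ₁ p) (δ₂ p)) s)
  (inj₂ h₂) → let (p , s) = sep₂ I J (AI , h₂) BJ in indist⇒¬sepAt (ind p) (SepAt-mono {δ₂} {δ₁ ⊕ δ₂} I J p (ℕ.m≤n+m (δ₂ p) (δ₁ p)) s)

∧-separator : ∀ {φ₁ φ₂ A B δ₁ δ₂} → (∀ J → B J → ¬ (J ⊨ (φ₁ ∧' φ₂))) →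
  IsSeparator (A , (λ J → B J × ¬ (J ⊨ φ₁))) δ₁ → IsSeparator (A , (λ J → B J × ¬ (J ⊨ φ₂))) δ₂ →
  IsSeparator (A , B) (δ₁ ⊕ δ₂)
∧-separator {δ₁ = δ₁} {δ₂} hB sep₁ sep₂ = separator-criterion λ {I} {J} AI BJ ind →
  let holds₁ = λ ¬h₁ → let (p , s) = sep₁ I J AI (BJ , ¬h₁) in indist⇒¬sepAt (ind p) (SepAt-mono {δ₁} {δ₁ ⊕ δ₂} I J p (ℕ.m≤m+n (δ₁ p) (δ₂ p)) s)
      holds₂ = λ ¬h₂ → let (p , s) = sep₂ I J AI (BJ , ¬h₂) in indist⇒¬sepAt (ind p) (SepAt-mono {δ₂} {δ₁ ⊕ δ₂} I J p (ℕ.m≤n+m (δ₂ p) (δ₁ p)) s)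
  in holds₁ λ h₁ → holds₂ λ h₂ → hB J BJ (h₁ , h₂)

∃-separator : ∀ {v A B δ₁} (ch : Interp → ℕ) (ch≤N : ∀ I → A I → ch I ℕ.≤ N I) →
  IsSeparator ((λ J → Σ Interp λ I → A I × Σ (ch I ℕ.≤ N I) λ p → J ≡ update I v (ch I) p) ,
               (λ J → Σ Interp λ I → B I × Σ ℕ λ b → Σ (b ℕ.≤ N I) λ p → J ≡ update I v b p)) δ₁ →
  IsSeparator (A , B) (quantSep v δ₁)
∃-separator {v} {δ₁ = δ₁} ch ch≤N sep₁ = separator-criterion λ {I} {J} AI BJ ind →
  let (b , b≤N , ind') = indist-extend v δ₁ ind (ch I) (ch≤N I AI)
      (p , s) = sep₁ _ _ (I , AI , ch≤N I AI , refl) (J , BJ , b , b≤N , refl)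
  in indist⇒¬sepAt (ind' p) s

∀-separator : ∀ {v A B δ₁} (ch : Interp → ℕ) (ch≤N : ∀ J → B J → ch J ℕ.≤ N J) →
  IsSeparator ((λ I → Σ Interp λ I' → A I' × Σ ℕ λ a → Σ (a ℕ.≤ N I') λ p → I ≡ update I' v a p) ,
               (λ J → Σ Interp λ J' → B J' × Σ (ch J' ℕ.≤ N J') λ p → J ≡ update J' v (ch J') p)) δ₁ →
  IsSeparator (A , B) (quantSep v δ₁)
∀-separator {v} {δ₁ = δ₁} ch ch≤N sep₁ = separator-criterion λ {I} {J} AI BJ ind →
  let (a , a≤N , ind') = indist-extend v δ₁ (Indist-sym ∘ ind) (ch J) (ch≤N J BJ)
      (p , s) = sep₁ _ _ (I , AI , a , a≤N , refl) (J , BJ , ch≤N J BJ , refl)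
  in indist⇒¬sepAt (ind' p) (SepAt-sym δ₁ _ _ p s)

⊨±-kids : ∀ n → il n ⊨± fm n → ∀ {c} → c ∈ kids (tree n) → il c ⊨± fm c
⊨±-kids (node leaf) _ ()
⊨±-kids (node (neg _)) (hA , hB) (here refl) = (λ J BJ ¬φ → hB J BJ ¬φ) , (λ I AI φ → hA I AI (λ ¬φ → ¬φ φ))
⊨±-kids (node (or _ _)) (_ , hB) (here refl) = (λ I AI ¬φ₁ → ¬φ₁ (proj₂ AI)) , (λ J BJ φ₁ → hB J BJ (inj₁ φ₁))
⊨±-kids (node (or _ _)) (_ , hB) (there (here refl)) = (λ I AI ¬φ₂ → ¬φ₂ (proj₂ AI)) , (λ J BJ φ₂ → hB J BJ (inj₂ φ₂))
⊨±-kids (node (and _ _)) (hA , _) (here refl) = (λ I AI ¬φ₁ → hA I AI (¬φ₁ ∘ proj₁)) , (λ J → proj₂)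
⊨±-kids (node (and _ _)) (hA , _) (there (here refl)) = (λ I AI ¬φ₂ → hA I AI (¬φ₂ ∘ proj₂)) , (λ J → proj₂)
⊨±-kids (node (ex {φ} {v} ch hch _)) (_ , hB) (here refl) =
  (λ { _ (I , AI , p , refl) ¬φ → ¬φ (subst (λ q → update I v (ch I) q ⊨ φ) (ℕ.≤-irrelevant _ _) (proj₂ (hch I AI))) }) ,
  (λ { _ (J , BJ , b , p , refl) holds → hB J BJ (b , p , holds) })
⊨±-kids (node (all {φ} {v} ch hch _)) (hA , _) (here refl) =
  (λ { _ (I , AI , a , p , refl) ¬φ → hA I AI (λ ∀φ → ¬φ (∀φ a p)) }) ,
  (λ { _ (J , BJ , p , refl) holds → proj₂ (hch J BJ) (subst (λ q → update J v (ch J) q ⊨ φ) (ℕ.≤-irrelevant _ _) holds) })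

⊨±-≼ : ∀ {s t} → s ≼ t → il t ⊨± fm t → il s ⊨± fm s
⊨±-≼ here h = h
⊨±-≼ (there {t} c∈ s≼c) h = ⊨±-≼ s≼c (⊨±-kids t h c∈)

nodeClaim : ∀ n → il n ⊨± fm n → NodeClaim n
nodeClaim (node {atom ρ u u'} leaf) h δ (_ , minimal) =
  let (δ' , sep , W≤1) = atom-separator ρ u u' h in ℕ.≤-trans (minimal δ' sep) W≤1
nodeClaim (node (neg _)) _ δ δ₁ (_ , minimal) (sep₁ , _) =
  inj₁ (ℕ.≤-trans (minimal δ₁ (IsSeparator-swap sep₁)) (ℕ.m≤m+n _ 4))
nodeClaim (node (or _ _)) (hA , _) δ δ₁ δ₂ (_ , minimal) (sep₁ , _) (sep₂ , _) =
  sqrtLe-⊕ δ₁ δ₂ (minimal (δ₁ ⊕ δ₂) (∨-separator hA sep₁ sep₂))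
nodeClaim (node (and _ _)) (_ , hB) δ δ₁ δ₂ (_ , minimal) (sep₁ , _) (sep₂ , _) =
  sqrtLe-⊕ δ₁ δ₂ (minimal (δ₁ ⊕ δ₂) (∧-separator hB sep₁ sep₂))
nodeClaim (node (ex {v = v} ch hch _)) _ δ δ₁ (_ , minimal) (sep₁ , _) =
  sqrtLe-quantSep v δ₁ (minimal (quantSep v δ₁) (∃-separator ch (λ I → proj₁ ∘ hch I) sep₁))
nodeClaim (node (all {v = v} ch hch _)) _ δ δ₁ (_ , minimal) (sep₁ , _) =
  sqrtLe-quantSep v δ₁ (minimal (quantSep v δ₁) (∀-separator ch (λ J → proj₁ ∘ hch J) sep₁))

lemma3p9 : (ψ : Form) (A B : Pred)
    → (∀ I → A I → I ⊨ ψ)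
    → (∀ J → B J → J ⊨ (¬' ψ))
    → (T : Tree ψ A B)
    → (v : Node) → v ≼ node T → NodeClaim v
lemma3p9 ψ A B hA hB T v v≼T = nodeClaim v (⊨±-≼ v≼T ((λ I AI ¬ψ → ¬ψ (hA I AI)) , hB))
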